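{- Let $B$ be a complete Boolean algebra such that the operation $\vee$ is continuous at $(\mathbf 0,\mathbf 0)$ with respect to $\tau_s$, i.e. for every $\tau_s$-neighborhood $V$ of $\mathbf 0$ there is a $\tau_s$-neighborhood $U$ of $\mathbf 0$ with $\{u\vee u':u,u'\in U\}\subseteq V$. Then $B$ is weakly distributive.
   Context: For a sequence $\langle b_n\rangle$ in $B$, let $\overline{\lim}\, b_n=\bigwedge_k\bigvee_{n\ge k}b_n$ and $\underline{\lim}\, b_n=\bigvee_k\bigwedge_{n\ge k}b_n$; the sequence algebraically converges to $b$ if both equal $b$. The sequential topology $\tau_s$ on $B$ is the largest topology on $B$ in which every algebraically convergent sequence converges to its algebraic limit. $B$ is weakly distributive if for every sequence $\{P_n\}$ of countable maximal antichains there is a dense set $Q$ (every nonzero $b$ has a nonzero $q\in Q$ with $q\le b$) such that each $q\in Q$ has nonzero meet with only finitely many elements of each $P_n$. -}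

module Defs where

open import Level using (Level; _⊔_; Lift; lift; suc)
open import Data.Nat using (ℕ; _≤_)
open import Data.Product using (Σ; _×_; _,_; ∃; ∃-syntax)
open import Data.Sum using (_⊎_)
open import Data.List using (List)
open import Data.List.Relation.Unary.Any using (Any)
open import Relation.Nullary using (¬_)
open import Algebra.Lattice.Bundles using (BooleanAlgebra)

record CompleteBooleanAlgebra (c ℓ : Level) : Set (suc (c ⊔ ℓ)) where
  field
    booleanAlgebra : BooleanAlgebra c ℓ
  open BooleanAlgebra booleanAlgebra public renaming (¬_ to ∁_)

  infix 4 _≤ᴮ_
  _≤ᴮ_ : Carrier → Carrier → Set ℓ
  x ≤ᴮ y = x ∧ y ≈ x

  field
    ⋁ : {I : Set c} → (I → Carrier) → Carrier
    ⋁-upper : {I : Set c} (f : I → Carrier) (i : I) → f i ≤ᴮ ⋁ f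
    ⋁-least : {I : Set c} (f : I → Carrier) (b : Carrier) →
              (∀ i → f i ≤ᴮ b) → ⋁ f ≤ᴮ b
    ⋀ : {I : Set c} → (I → Carrier) → Carrier
    ⋀-lower : {I : Set c} (f : I → Carrier) (i : I) → ⋀ f ≤ᴮ f i
    ⋀-greatest : {I : Set c} (f : I → Carrier) (b : Carrier) →
                 (∀ i → b ≤ᴮ f i) → b ≤ᴮ ⋀ f

module _ {c ℓ : Level} (B : CompleteBooleanAlgebra c ℓ) where
  open CompleteBooleanAlgebra B

  Tail : ℕ → Set c
  Tail k = Lift c (Σ ℕ λ n → k ≤ n)

  limsup : (ℕ → Carrier) → Carrier
  limsup b = ⋀ {Lift c ℕ} λ { (lift k) → ⋁ {Tail k} λ { (lift (n , _)) → b n } }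

  liminf : (ℕ → Carrier) → Carrier
  liminf b = ⋁ {Lift c ℕ} λ { (lift k) → ⋀ {Tail k} λ { (lift (n , _)) → b n } }

  AlgConv : (ℕ → Carrier) → Carrier → Set ℓ
  AlgConv b x = (limsup b ≈ x) × (liminf b ≈ x)

  Subset : Set (suc c)
  Subset = Carrier → Set c

  -- τ_s-open sets: the open sets of the largest topology in which every
  -- algebraically convergent sequence converges to its algebraic limit, i.e.
  -- O is open iff every algebraically convergent sequence whose limit lies in O
  -- is eventually in O.
  IsSeqOpen : Subset → Set (c ⊔ ℓ)
  IsSeqOpen O = (b : ℕ → Carrier) (x : Carrier) → AlgConv b x → O x →
                ∃[ k ] (∀ n → k ≤ n → O (b n))

  IsNbhd0 : Subset → Set (suc c ⊔ ℓ)
  IsNbhd0 V = ∃[ O ] (IsSeqOpen O × O ⊥ × (∀ x → O x → V x))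

  JoinContinuousAt00 : Set (suc c ⊔ ℓ)
  JoinContinuousAt00 = (V : Subset) → IsNbhd0 V →
    ∃[ U ] (IsNbhd0 U × (∀ u u' → U u → U u' → V (u ∨ u')))

  IsAntichain : Subset → Set (c ⊔ ℓ)
  IsAntichain P = (∀ p → P p → ¬ (p ≈ ⊥)) ×
                  (∀ p q → P p → P q → ¬ (p ≈ q) → p ∧ q ≈ ⊥)

  IsMaximalAntichain : Subset → Set (c ⊔ ℓ)
  IsMaximalAntichain P = IsAntichain P ×
    ((a : Carrier) → ¬ (a ≈ ⊥) → (∀ p → P p → ¬ (p ≈ a) → p ∧ a ≈ ⊥) →
       ∃[ p ] (P p × p ≈ a))

  IsCountable : Subset → Set (c ⊔ ℓ)
  IsCountable P = (∀ x → ¬ P x) ⊎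
    (Σ (ℕ → Carrier) λ f → (∀ n → P (f n)) × (∀ x → P x → ∃[ n ] (f n ≈ x)))

  IsDense : Subset → Set (c ⊔ ℓ)
  IsDense Q = ∀ b → ¬ (b ≈ ⊥) → ∃[ q ] (Q q × ¬ (q ≈ ⊥) × q ≤ᴮ b)

  MeetsFinitelyMany : Carrier → Subset → Set (c ⊔ ℓ)
  MeetsFinitelyMany q P = ∃[ L ] (∀ p → P p → ¬ (q ∧ p ≈ ⊥) → Any (_≈ p) L)

  WeaklyDistributive : Set (suc c ⊔ ℓ)
  WeaklyDistributive = (P : ℕ → Subset) →
    (∀ n → IsCountable (P n) × IsMaximalAntichain (P n)) →
    ∃[ Q ] (IsDense Q × (∀ q → Q q → ∀ n → MeetsFinitelyMany q (P n)))

module Submission where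

-- For b ≠ ⊥ the set {x | b ≰ x} is a τ_s-open neighbourhood of ⊥, and continuity of ∨ at (⊥,⊥)
-- refines it to open neighbourhoods C₀ ⊇ C₁ ⊇ … of ⊥ with Cᵢ₊₁ ∨ Cᵢ₊₁ ⊆ Cᵢ. Enumerating Pₙ as
-- gₙ₀, gₙ₁, …, the complements of the partial joins gₙ₀ ∨ … ∨ gₙₘ decrease algebraically to ⊥
-- (Pₙ is maximal, so ⋁ Pₙ = ⊤), hence one of them, dₙ, lies in Cₙ₊₂. Then D = ⋁ₙ dₙ lies in C₀,
-- that is b ≰ D, so b ∧ ∁ D ≠ ⊥; and b ∧ ∁ D lies below a finite partial join of every Pₙ, so it
-- meets only finitely many members of each Pₙ.

open import Level using (Level; Lift; lift; _⊔_) renaming (suc to lsuc)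
open import Axiom.ExcludedMiddle using (ExcludedMiddle)
open import Axiom.DoubleNegationElimination using (em⇒dne)
open import Data.Nat as ℕ using (ℕ; zero; suc; _≤′_; ≤′-refl; ≤′-step)
import Data.Nat.Properties as ℕ
open import Data.Product using (Σ; _×_; _,_; ∃; ∃-syntax; ∃₂; proj₁; proj₂)
open import Data.Sum using (inj₁; inj₂)
open import Data.Empty using (⊥-elim)
open import Data.List using ([]; applyUpTo)
open import Data.List.Relation.Unary.Any as Any using (Any)
open import Data.List.Membership.Propositional.Properties using (∈-applyUpTo⁺)
open import Relation.Nullary using (¬_)
open import Relation.Nullary.Decidable using (False; toWitnessFalse; fromWitnessFalse)
open import Relation.Binary.PropositionalEquality using (_≡_; refl)
open import Relation.Binary.Structures using (IsPartialOrder)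
import Relation.Binary.Lattice.Bundles as OrderTheoretic
import Relation.Binary.Lattice.Properties.JoinSemilattice as JoinSemilatticeProperties
import Relation.Binary.Lattice.Properties.MeetSemilattice as MeetSemilatticeProperties
import Relation.Binary.Reasoning.Setoid as SetoidReasoning
import Algebra.Lattice.Properties.Lattice as LatticeProperties
import Algebra.Lattice.Properties.BooleanAlgebra as BooleanAlgebraProperties
open import Defs

module BooleanOrder {c ℓ : Level} (B : CompleteBooleanAlgebra c ℓ) where
  open CompleteBooleanAlgebra B
  open BooleanAlgebraProperties booleanAlgebra
    using (∧-identityʳ; ∨-identityˡ; ∨-identityʳ; ∧-zeroˡ; ∧-zeroʳ; ¬-involutive)
  open LatticeProperties lattice using (∧-idem)
  private
    module Natural = OrderTheoretic.Lattice (LatticeProperties.∨-∧-orderTheoreticLattice lattice)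

  -- The library orders a lattice by  x ≈ x ∧ y;  _≤ᴮ_ is the symmetric form of that order.
  ≤-isPartialOrder : IsPartialOrder _≈_ _≤ᴮ_
  ≤-isPartialOrder = record
    { isPreorder = record
      { isEquivalence = isEquivalence
      ; reflexive     = λ x≈y → sym (Natural.reflexive x≈y)
      ; trans         = λ x≤y y≤z → sym (Natural.trans (sym x≤y) (sym y≤z))
      }
    ; antisym = λ x≤y y≤x → Natural.antisym (sym x≤y) (sym y≤x)
    }

  orderLattice : OrderTheoretic.Lattice c ℓ ℓ
  orderLattice = record
    { isLattice = record
      { isPartialOrder = ≤-isPartialOrder
      ; supremum       = λ x y → let (x≤ , y≤ , least) = Natural.supremum x y in
                           sym x≤ , sym y≤ , λ z p q → sym (least z (sym p) (sym q))
      ; infimum        = λ x y → let (≤x , ≤y , greatest) = Natural.infimum x y in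
                           sym ≤x , sym ≤y , λ z p q → sym (greatest z (sym p) (sym q))
      }
    }

  open OrderTheoretic.Lattice orderLattice public
    using (x≤x∨y; y≤x∨y; ∨-least; x∧y≤x; x∧y≤y; ≤-respˡ-≈; ≤-respʳ-≈)
    renaming (refl to ≤-refl; trans to ≤-trans; antisym to ≤-antisym; reflexive to ≤-reflexive)
  open JoinSemilatticeProperties (OrderTheoretic.Lattice.joinSemilattice orderLattice) public
    using (∨-monotonic)
  open MeetSemilatticeProperties (OrderTheoretic.Lattice.meetSemilattice orderLattice) public
    using (∧-monotonic)

  ⊥-minimum : ∀ x → ⊥ ≤ᴮ x
  ⊥-minimum = ∧-zeroˡ

  x≤⊥⇒x≈⊥ : ∀ {x} → x ≤ᴮ ⊥ → x ≈ ⊥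
  x≤⊥⇒x≈⊥ {x} x≤⊥ = trans (sym x≤⊥) (∧-zeroʳ x)

  disjoint⇒≤∁ : ∀ {x y} → x ∧ y ≈ ⊥ → x ≤ᴮ ∁ y
  disjoint⇒≤∁ {x} {y} x∧y≈⊥ = sym (begin
    x                    ≈⟨ sym (∧-identityʳ x) ⟩
    x ∧ ⊤                ≈⟨ ∧-congˡ (sym (∨-complementʳ y)) ⟩
    x ∧ (y ∨ ∁ y)        ≈⟨ ∧-distribˡ-∨ x y (∁ y) ⟩
    x ∧ y ∨ x ∧ ∁ y      ≈⟨ ∨-congʳ x∧y≈⊥ ⟩
    ⊥ ∨ x ∧ ∁ y          ≈⟨ ∨-identityˡ _ ⟩
    x ∧ ∁ y              ∎)
    where open SetoidReasoning setoid

  ≤∁⇒disjoint : ∀ {x y} → x ≤ᴮ ∁ y → x ∧ y ≈ ⊥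
  ≤∁⇒disjoint {x} {y} x≤∁y =
    x≤⊥⇒x≈⊥ (≤-trans (∧-monotonic x≤∁y ≤-refl) (≤-reflexive (∧-complementˡ y)))

  ≤∁-swap : ∀ {x y} → x ≤ᴮ ∁ y → y ≤ᴮ ∁ x
  ≤∁-swap x≤∁y = disjoint⇒≤∁ (trans (∧-comm _ _) (≤∁⇒disjoint x≤∁y))

  ∁-antitone : ∀ {x y} → x ≤ᴮ y → ∁ y ≤ᴮ ∁ x
  ∁-antitone x≤y = ≤∁-swap (≤-trans x≤y (≤-reflexive (sym (¬-involutive _))))

  ≤∁-self⇒≈⊥ : ∀ {x} → x ≤ᴮ ∁ x → x ≈ ⊥
  ≤∁-self⇒≈⊥ {x} x≤∁x = trans (sym (∧-idem x)) (≤∁⇒disjoint x≤∁x)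

  ∁≈⊥⇒≈⊤ : ∀ {x} → ∁ x ≈ ⊥ → x ≈ ⊤
  ∁≈⊥⇒≈⊤ {x} ∁x≈⊥ = trans (sym (∨-identityʳ x)) (trans (∨-congˡ (sym ∁x≈⊥)) (∨-complementʳ x))

  x≤y⇒y≈x∨[y∧∁x] : ∀ {x y} → x ≤ᴮ y → y ≈ x ∨ (y ∧ ∁ x)
  x≤y⇒y≈x∨[y∧∁x] {x} {y} x≤y = ≤-antisym
    (≤-respˡ-≈ (∧-identityʳ y) (≤-respˡ-≈ (∧-congˡ (∨-complementʳ x))
      (≤-respˡ-≈ (sym (∧-distribˡ-∨ y x (∁ x))) (∨-monotonic (x∧y≤y y x) ≤-refl))))
    (∨-least x≤y (x∧y≤x y (∁ x)))

  ⋁ₙ : (ℕ → Carrier) → Carrier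
  ⋁ₙ a = ⋁ {Lift c ℕ} λ { (lift n) → a n }

  ⋀ₙ : (ℕ → Carrier) → Carrier
  ⋀ₙ a = ⋀ {Lift c ℕ} λ { (lift n) → a n }

  ≤⋁ₙ : ∀ a n → a n ≤ᴮ ⋁ₙ a
  ≤⋁ₙ a n = ⋁-upper _ (lift n)

  ⋁ₙ-least : ∀ a {b} → (∀ n → a n ≤ᴮ b) → ⋁ₙ a ≤ᴮ b
  ⋁ₙ-least a {b} a≤b = ⋁-least _ b λ { (lift n) → a≤b n }

  ⋀ₙ≤ : ∀ a n → ⋀ₙ a ≤ᴮ a n
  ⋀ₙ≤ a n = ⋀-lower _ (lift n)

  ⋀ₙ-greatest : ∀ a {b} → (∀ n → b ≤ᴮ a n) → b ≤ᴮ ⋀ₙ a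
  ⋀ₙ-greatest a {b} b≤a = ⋀-greatest _ b λ { (lift n) → b≤a n }

  disjoint-below-⋁ₙ⇒≈⊥ : ∀ a {z} → z ≤ᴮ ⋁ₙ a → (∀ n → z ≤ᴮ ∁ (a n)) → z ≈ ⊥
  disjoint-below-⋁ₙ⇒≈⊥ a z≤⋁a z≤∁a =
    ≤∁-self⇒≈⊥ (≤-trans z≤⋁a (⋁ₙ-least a λ n → ≤∁-swap (z≤∁a n)))

  partialJoin : (ℕ → Carrier) → ℕ → Carrier
  partialJoin a zero    = ⊥
  partialJoin a (suc k) = partialJoin a k ∨ a k

  partialJoin-monotone : ∀ a {m n} → m ≤′ n → partialJoin a m ≤ᴮ partialJoin a n
  partialJoin-monotone a ≤′-refl        = ≤-refl
  partialJoin-monotone a (≤′-step m≤′n) = ≤-trans (partialJoin-monotone a m≤′n) (x≤x∨y _ _)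

  partialJoin≤⋁ₙ : ∀ a k → partialJoin a k ≤ᴮ ⋁ₙ a
  partialJoin≤⋁ₙ a zero    = ⊥-minimum _
  partialJoin≤⋁ₙ a (suc k) = ∨-least (partialJoin≤⋁ₙ a k) (≤⋁ₙ a k)

  partialJoin-least : ∀ a {b} k → (∀ j → j ℕ.< k → a j ≤ᴮ b) → partialJoin a k ≤ᴮ b
  partialJoin-least a zero    a≤b = ⊥-minimum _
  partialJoin-least a (suc k) a≤b =
    ∨-least (partialJoin-least a k λ j j<k → a≤b j (ℕ.m<n⇒m<1+n j<k)) (a≤b k ℕ.≤-refl)

module SequentialTopology {c ℓ : Level} (B : CompleteBooleanAlgebra c ℓ) where
  open CompleteBooleanAlgebra B
  open BooleanAlgebraProperties booleanAlgebra using (∧-identityʳ; ∨-identityˡ; ∨-identityʳ)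
  open BooleanOrder B

  constant-algConv : ∀ {x y} → x ≈ y → AlgConv B (λ _ → y) x
  constant-algConv {x} {y} x≈y =
    ≤-antisym (≤-trans (⋀-lower _ (lift 0)) (⋁-least _ x λ _ → ≤-reflexive (sym x≈y)))
              (⋀-greatest _ x λ { (lift k) → ≤-trans (≤-reflexive x≈y) (⋁-upper _ (lift (k , ℕ.≤-refl))) }) ,
    ≤-antisym (⋁-least _ x λ { (lift k) → ≤-trans (⋀-lower _ (lift (k , ℕ.≤-refl))) (≤-reflexive (sym x≈y)) })
              (≤-trans (≤-reflexive x≈y) (≤-trans (⋀-greatest _ y λ _ → ≤-refl) (⋁-upper _ (lift 0))))

  isSeqOpen-resp-≈ : ∀ {O} → IsSeqOpen B O → ∀ {x y} → x ≈ y → O x → O y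
  isSeqOpen-resp-≈ O-open x≈y Ox = let (k , eventually) = O-open _ _ (constant-algConv x≈y) Ox in
    eventually k ℕ.≤-refl

  antitone-algConv-⊥ : ∀ x → (∀ {m n} → m ℕ.≤ n → x n ≤ᴮ x m) →
                       (∀ z → (∀ k → z ≤ᴮ x k) → z ≈ ⊥) → AlgConv B x ⊥
  antitone-algConv-⊥ x antitone onlyTrivialLowerBound =
    onlyTrivialLowerBound _ (λ k →
      ≤-trans (⋀-lower _ (lift k)) (⋁-least _ (x k) λ { (lift (n , k≤n)) → antitone k≤n })) ,
    x≤⊥⇒x≈⊥ (⋁-least _ ⊥ λ { (lift k) → ≤-reflexive (onlyTrivialLowerBound _ λ j →
      ≤-trans (⋀-lower _ (lift (j ℕ.⊔ k , ℕ.m≤n⊔m j k))) (antitone (ℕ.m≤m⊔n j k))) })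

  complement-partialJoin-algConv : ∀ a → ⋁ₙ a ≈ ⊤ → AlgConv B (λ k → ∁ (partialJoin a k)) ⊥
  complement-partialJoin-algConv a ⋁a≈⊤ =
    antitone-algConv-⊥ _ (λ m≤n → ∁-antitone (partialJoin-monotone a (ℕ.≤⇒≤′ m≤n)))
      λ z z≤∁partial → disjoint-below-⋁ₙ⇒≈⊥ a (≤-respʳ-≈ (sym ⋁a≈⊤) (∧-identityʳ z))
        λ n → ≤-trans (z≤∁partial (suc n)) (∁-antitone (y≤x∨y _ _))

  remainder-algConv : ∀ a → AlgConv B (λ k → ⋁ₙ a ∧ ∁ (partialJoin a k)) ⊥
  remainder-algConv a =
    antitone-algConv-⊥ _ (λ m≤n → ∧-monotonic ≤-refl (∁-antitone (partialJoin-monotone a (ℕ.≤⇒≤′ m≤n))))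
      λ z z≤remainder → disjoint-below-⋁ₙ⇒≈⊥ a (≤-trans (z≤remainder 0) (x∧y≤x _ _))
        λ n → ≤-trans (z≤remainder (suc n)) (≤-trans (x∧y≤y _ _) (∁-antitone (y≤x∨y _ _)))

  record OpenNbhd⊥ : Set (lsuc c ⊔ ℓ) where
    infix 4 _∋_
    field
      _∋_       : Carrier → Set c
      isSeqOpen : IsSeqOpen B _∋_
      ∋⊥        : _∋_ ⊥

    ∋-resp-≈ : ∀ {x y} → x ≈ y → _∋_ x → _∋_ y
    ∋-resp-≈ = isSeqOpen-resp-≈ isSeqOpen

  open OpenNbhd⊥ public

  JoinsInto : OpenNbhd⊥ → OpenNbhd⊥ → Set c
  JoinsInto U V = ∀ {u u'} → U ∋ u → U ∋ u' → V ∋ (u ∨ u')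

  halve : JoinContinuousAt00 B → (V : OpenNbhd⊥) → Σ OpenNbhd⊥ λ U → JoinsInto U V
  halve continuous V =
    let (_ , (O , O-open , O∋⊥ , O⊆U) , U∨U⊆V) = continuous (V ∋_) ((V ∋_) , isSeqOpen V , ∋⊥ V , λ _ Vx → Vx)
    in record { _∋_ = O ; isSeqOpen = O-open ; ∋⊥ = O∋⊥ } ,
       λ Ou Ou' → U∨U⊆V _ _ (O⊆U _ Ou) (O⊆U _ Ou')

  halvingChain : JoinContinuousAt00 B → OpenNbhd⊥ → ℕ → OpenNbhd⊥
  halvingChain continuous V zero    = V
  halvingChain continuous V (suc i) = proj₁ (halve continuous (halvingChain continuous V i))

  halvingChain-joinsInto : ∀ continuous V i →
    JoinsInto (halvingChain continuous V (suc i)) (halvingChain continuous V i)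
  halvingChain-joinsInto continuous V i = proj₂ (halve continuous (halvingChain continuous V i))

  -- The partial joins a₀ ∨ … ∨ aₖ₋₁ stay in C₁, and the remainders ⋁ a ∧ ∁ (a₀ ∨ … ∨ aₖ₋₁)
  -- tend to ⊥, so are eventually in C₁ too; joining one of each lands in C₀.
  ⋁ₙ-∈-chain : (C : ℕ → OpenNbhd⊥) → (∀ i → JoinsInto (C (suc i)) (C i)) →
               ∀ a → (∀ n → C (2 ℕ.+ n) ∋ a n) → C 0 ∋ ⋁ₙ a
  ⋁ₙ-∈-chain C joinsInto a C∋a =
    ∋-resp-≈ (C 0) (sym (x≤y⇒y≈x∨[y∧∁x] (partialJoin≤⋁ₙ a k)))
      (joinsInto 0 (partialJoin-∈ k) (remainder-eventually-∈ k ℕ.≤-refl))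
    where
    partialJoin-∨-∈ : ∀ k {y} → C (suc k) ∋ y → C 1 ∋ (partialJoin a k ∨ y)
    partialJoin-∨-∈ zero    C₁∋y = ∋-resp-≈ (C 1) (sym (∨-identityˡ _)) C₁∋y
    partialJoin-∨-∈ (suc k) C∋y  = ∋-resp-≈ (C 1) (sym (∨-assoc _ _ _))
      (partialJoin-∨-∈ k (joinsInto (suc k) (C∋a k) C∋y))

    partialJoin-∈ : ∀ k → C 1 ∋ partialJoin a k
    partialJoin-∈ k = ∋-resp-≈ (C 1) (∨-identityʳ _) (partialJoin-∨-∈ k (∋⊥ (C (suc k))))

    remainder-eventually : ∃[ k ] (∀ n → k ℕ.≤ n → C 1 ∋ (⋁ₙ a ∧ ∁ (partialJoin a n)))
    remainder-eventually = isSeqOpen (C 1) _ ⊥ (remainder-algConv a) (∋⊥ (C 1))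

    k = proj₁ remainder-eventually
    remainder-eventually-∈ = proj₂ remainder-eventually

module WeakDistributivity (em : ∀ {a} → ExcludedMiddle a) {c ℓ : Level} (B : CompleteBooleanAlgebra c ℓ) where
  open CompleteBooleanAlgebra B hiding (refl)
  open BooleanAlgebraProperties booleanAlgebra using (¬-involutive)
  open LatticeProperties lattice using (∧-idem)
  open BooleanOrder B
  open SequentialTopology B

  private
    dne : ∀ {a} {X : Set a} → ¬ ¬ X → X
    dne = em⇒dne em

  -- ¬ b ≤ᴮ x lives in Set ℓ, but a subset needs Set c: decide it and keep the (small) boolean verdict.
  NotAbove : Carrier → Subset B
  NotAbove b x = Lift c (False (em {P = b ≤ᴮ x}))

  notAbove-isSeqOpen : ∀ b → IsSeqOpen B (NotAbove b)
  notAbove-isSeqOpen b x y (limsup≈y , _) (lift b≰y) = dne λ ¬eventually →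
    toWitnessFalse b≰y (≤-respʳ-≈ limsup≈y (⋀-greatest _ b λ { (lift k) → frequently ¬eventually k }))
    where
    frequently : ¬ (∃[ k ] (∀ n → k ℕ.≤ n → NotAbove b (x n))) →
                 ∀ k → b ≤ᴮ ⋁ {Tail B k} (λ { (lift (n , _)) → x n })
    frequently ¬eventually k =
      let (n , k≤n , b≤xn) = dne λ ¬above →
            ¬eventually (k , λ n k≤n → lift (fromWitnessFalse λ b≤xn → ¬above (n , k≤n , b≤xn)))
      in ≤-trans b≤xn (⋁-upper _ (lift (n , k≤n)))

  notAbove : ∀ b → ¬ b ≈ ⊥ → OpenNbhd⊥
  notAbove b b≉⊥ = record
    { _∋_       = NotAbove b
    ; isSeqOpen = notAbove-isSeqOpen b
    ; ∋⊥        = lift (fromWitnessFalse λ b≤⊥ → b≉⊥ (x≤⊥⇒x≈⊥ b≤⊥))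
    }

  notAbove⇒≰ : ∀ {b x} → NotAbove b x → ¬ b ≤ᴮ x
  notAbove⇒≰ (lift b≰x) = toWitnessFalse b≰x

  upperBound-maximalAntichain≈⊤ : ∀ {P} → IsMaximalAntichain B P → ∀ {s} → (∀ p → P p → p ≤ᴮ s) → s ≈ ⊤
  upperBound-maximalAntichain≈⊤ {P} ((nonzero , _) , maximal) {s} p≤s = ∁≈⊥⇒≈⊤ (dne λ ∁s≉⊥ →
    let (p , Pp , p≈∁s) = maximal (∁ s) ∁s≉⊥ λ p Pp _ → disjoint-∁s p Pp
    in nonzero p Pp (trans (sym (∧-idem p)) (trans (∧-congˡ p≈∁s) (disjoint-∁s p Pp))))
    where
    disjoint-∁s : ∀ p → P p → p ∧ ∁ s ≈ ⊥
    disjoint-∁s p Pp = ≤∁⇒disjoint (≤-respʳ-≈ (sym (¬-involutive s)) (p≤s p Pp))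

  enumeration : ∀ {P} → IsCountable B P → ℕ → Carrier
  enumeration (inj₁ _)       _ = ⊥
  enumeration (inj₂ (f , _))   = f

  ≤⋁ₙ-enumeration : ∀ {P} (countable : IsCountable B P) → ∀ p → P p → p ≤ᴮ ⋁ₙ (enumeration countable)
  ≤⋁ₙ-enumeration (inj₁ empty)           p Pp = ⊥-elim (empty p Pp)
  ≤⋁ₙ-enumeration (inj₂ (f , _ , onto)) p Pp = let (n , fn≈p) = onto p Pp in ≤-respˡ-≈ fn≈p (≤⋁ₙ f n)

  below-partialJoin-meetsFinitelyMany : ∀ {P} (countable : IsCountable B P) → IsAntichain B P →
    ∀ {q} m → q ≤ᴮ partialJoin (enumeration countable) m → MeetsFinitelyMany B q P
  below-partialJoin-meetsFinitelyMany (inj₁ empty) _ _ _ = [] , λ p Pp _ → ⊥-elim (empty p Pp)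
  below-partialJoin-meetsFinitelyMany {P} (inj₂ (f , inP , _)) (_ , disjoint) {q} m q≤ =
    applyUpTo f m , listed
    where
    listed : ∀ p → P p → ¬ q ∧ p ≈ ⊥ → Any (_≈ p) (applyUpTo f m)
    listed p Pp q∧p≉⊥ = dne λ unlisted → q∧p≉⊥ (≤∁⇒disjoint (≤-trans q≤
      (partialJoin-least f m λ j j<m → disjoint⇒≤∁ (disjoint (f j) p (inP j) Pp λ fj≈p →
        unlisted (Any.map (λ { refl → fj≈p }) (∈-applyUpTo⁺ f j<m))))))

  module _ (P : ℕ → Subset B) (H : ∀ n → IsCountable B (P n) × IsMaximalAntichain B (P n)) where
    private
      g : ℕ → ℕ → Carrier
      g n = enumeration (proj₁ (H n))

    cover : (ℕ → ℕ) → Carrier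
    cover f = ⋀ₙ λ n → partialJoin (g n) (f n)

    -- The elements below some cover, listed as meets because _≤ᴮ_ is not in Set c.
    BelowCover : Subset B
    BelowCover q = ∃₂ λ f b → q ≡ b ∧ cover f

    belowCover-meetsFinitelyMany : ∀ q → BelowCover q → ∀ n → MeetsFinitelyMany B q (P n)
    belowCover-meetsFinitelyMany _ (f , b , refl) n =
      below-partialJoin-meetsFinitelyMany (proj₁ (H n)) (proj₁ (proj₂ (H n))) (f n)
        (≤-trans (x∧y≤y b _) (⋀ₙ≤ _ n))

    belowCover-dense : JoinContinuousAt00 B → IsDense B BelowCover
    belowCover-dense continuous b b≉⊥ = b ∧ cover f , (f , b , refl) , nonzero , x∧y≤x b _
      where
      C : ℕ → OpenNbhd⊥
      C = halvingChain continuous (notAbove b b≉⊥)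

      eventually : ∀ n → ∃[ m ] (∀ m' → m ℕ.≤ m' → C (2 ℕ.+ n) ∋ ∁ (partialJoin (g n) m'))
      eventually n = isSeqOpen (C (2 ℕ.+ n)) _ ⊥
        (complement-partialJoin-algConv (g n)
          (upperBound-maximalAntichain≈⊤ (proj₂ (H n)) (≤⋁ₙ-enumeration (proj₁ (H n)))))
        (∋⊥ (C (2 ℕ.+ n)))

      f : ℕ → ℕ
      f n = proj₁ (eventually n)

      D : Carrier
      D = ⋁ₙ λ n → ∁ (partialJoin (g n) (f n))

      b≰D : ¬ b ≤ᴮ D
      b≰D = notAbove⇒≰ (⋁ₙ-∈-chain C (halvingChain-joinsInto continuous _) _
        λ n → proj₂ (eventually n) (f n) ℕ.≤-refl)

      ∁D≤cover : ∁ D ≤ᴮ cover f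
      ∁D≤cover = ⋀ₙ-greatest _ λ n → ≤-respʳ-≈ (¬-involutive _) (∁-antitone (≤⋁ₙ _ n))

      nonzero : ¬ b ∧ cover f ≈ ⊥
      nonzero b∧cover≈⊥ =
        b≰D (≤-respʳ-≈ (¬-involutive D) (≤-trans (disjoint⇒≤∁ b∧cover≈⊥) (∁-antitone ∁D≤cover)))

lemma5p4 : (∀ {a} → ExcludedMiddle a) → {c ℓ : Level} (B : CompleteBooleanAlgebra c ℓ) →
    JoinContinuousAt00 B → WeaklyDistributive B
lemma5p4 em B continuous P H =
  BelowCover P H , belowCover-dense P H continuous , belowCover-meetsFinitelyMany P H
  where open WeakDistributivity em B
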